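{- Let $K$ be a dp-Kleene algebra, $x,y\in K$ and $p\in d(K)=\{d(z)\mid z\in K\}$. If $x\cdot p\le p\cdot y$, then $x^\ast\cdot p\le p\cdot y^\ast$.
   Context: A proto-dioid is a structure $(S,+,\cdot,0,1_\sigma)$ such that $+$ is associative, commutative, idempotent with unit $0$ (order $x\le y\iff x+y=y$), and $1_\sigma\cdot x=x$, $x\cdot 1_\sigma=x$, $x\cdot y+x\cdot z\le x\cdot(y+z)$, $(x+y)\cdot z=x\cdot z+y\cdot z$, $0\cdot x=0$. A dp-dioid is a proto-dioid with unary $d$ such that $x\cdot(y\cdot z)=(x\cdot y)\cdot z$ whenever one of $x,y,z$ equals $d(w)$, and $x\le d(x)\cdot x$, $d(x\cdot y)=d(x\cdot d(y))$, $d(x+y)=d(x)+d(y)$, $d(x)\le 1_\sigma$, $d(0)=0$. A dp-Kleene algebra is a dp-dioid with unary $^\ast$ satisfying $1_\sigma+x\cdot x^\ast\le x^\ast$ and $d(z)+x\cdot y\le y\Rightarrow x^\ast\cdot d(z)\le y$. -}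

module Defs where

open import Level using (Level; suc)
open import Relation.Binary.PropositionalEquality using (_≡_)
open import Data.Product using (∃-syntax)
open import Data.Sum using (_⊎_)

record ProtoDioid (c : Level) : Set (suc c) where
  infixl 6 _+_
  infixl 7 _·_
  infix 4 _≤_
  field
    Carrier : Set c
    _+_ : Carrier → Carrier → Carrier
    _·_ : Carrier → Carrier → Carrier
    𝟘 : Carrier
    𝟙 : Carrier

  _≤_ : Carrier → Carrier → Set c
  x ≤ y = x + y ≡ y

  field
    +-assoc : ∀ x y z → (x + y) + z ≡ x + (y + z)
    +-comm : ∀ x y → x + y ≡ y + x
    +-idem : ∀ x → x + x ≡ x
    +-identityˡ : ∀ x → 𝟘 + x ≡ x
    ·-identityˡ : ∀ x → 𝟙 · x ≡ x
    ·-identityʳ : ∀ x → x · 𝟙 ≡ x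
    ·-subdistribˡ : ∀ x y z → x · y + x · z ≤ x · (y + z)
    ·-distribʳ : ∀ x y z → (x + y) · z ≡ x · z + y · z
    ·-zeroˡ : ∀ x → 𝟘 · x ≡ 𝟘

record DpDioid (c : Level) : Set (suc c) where
  field
    protoDioid : ProtoDioid c
  open ProtoDioid protoDioid public
  field
    d : Carrier → Carrier
    ·-assoc-d : ∀ x y z →
      (∃[ w ] (x ≡ d w ⊎ y ≡ d w ⊎ z ≡ d w)) →
      x · (y · z) ≡ (x · y) · z
    d-absorb : ∀ x → x ≤ d x · x
    d-locality : ∀ x y → d (x · y) ≡ d (x · d y)
    d-additive : ∀ x y → d (x + y) ≡ d x + d y
    d-≤-𝟙 : ∀ x → d x ≤ 𝟙
    d-zero : d 𝟘 ≡ 𝟘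

record DpKleeneAlgebra (c : Level) : Set (suc c) where
  field
    dpDioid : DpDioid c
  open DpDioid dpDioid public
  field
    _⋆ : Carrier → Carrier
    ⋆-unfold : ∀ x → 𝟙 + x · (x ⋆) ≤ x ⋆
    ⋆-induct : ∀ x y z → d z + x · y ≤ y → (x ⋆) · d z ≤ y

-- Star induction at the domain element p shows x⋆ · p ≤ w for every w with p + x · w ≤ w, and
-- w := p · y⋆ is such a solution: x · (p · y⋆) ≤ p · (y · y⋆) by the hypothesis, and
-- p + p · (y · y⋆) ≤ p · (𝟙 + y · y⋆) ≤ p · y⋆ by star unfolding.  Multiplication is
-- only associative around domain elements, which is where p ∈ d(K) is needed.
module Submission where

open import Defs
open import Level using (Level)
open import Relation.Binary.PropositionalEquality
open import Data.Product using (∃-syntax; _,_)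
open import Data.Sum using (inj₁; inj₂)
open import Relation.Binary.Bundles using (Poset)
open import Relation.Binary.Structures using (IsPartialOrder)

module ProtoDioidOrder {c : Level} (P : ProtoDioid c) where
  open ProtoDioid P

  ≤-reflexive : ∀ {a b} → a ≡ b → a ≤ b
  ≤-reflexive {a} refl = +-idem a

  ≤-trans : ∀ {a b e} → a ≤ b → b ≤ e → a ≤ e
  ≤-trans {a} {b} {e} a≤b b≤e = begin
    a + e        ≡⟨ cong (a +_) b≤e ⟨
    a + (b + e)  ≡⟨ +-assoc a b e ⟨
    (a + b) + e  ≡⟨ cong (_+ e) a≤b ⟩
    b + e        ≡⟨ b≤e ⟩
    e            ∎
    where open ≡-Reasoning

  ≤-antisym : ∀ {a b} → a ≤ b → b ≤ a → a ≡ b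
  ≤-antisym {a} {b} a≤b b≤a = trans (sym b≤a) (trans (+-comm b a) a≤b)

  ≤-isPartialOrder : IsPartialOrder _≡_ _≤_
  ≤-isPartialOrder = record
    { isPreorder = record
      { isEquivalence = isEquivalence
      ; reflexive     = ≤-reflexive
      ; trans         = ≤-trans
      }
    ; antisym = ≤-antisym
    }

  ≤-poset : Poset c c c
  ≤-poset = record { isPartialOrder = ≤-isPartialOrder }

  x≤x+y : ∀ a b → a ≤ a + b
  x≤x+y a b = trans (sym (+-assoc a a b)) (cong (_+ b) (+-idem a))

  y≤x+y : ∀ a b → b ≤ a + b
  y≤x+y a b = subst (b ≤_) (+-comm b a) (x≤x+y b a)

  +-lub : ∀ {a b e} → a ≤ e → b ≤ e → a + b ≤ e
  +-lub {a} {b} {e} a≤e b≤e = trans (+-assoc a b e) (trans (cong (a +_) b≤e) a≤e)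

  +-monoʳ-≤ : ∀ e {a b} → a ≤ b → e + a ≤ e + b
  +-monoʳ-≤ e {b = b} a≤b = +-lub (x≤x+y e b) (≤-trans a≤b (y≤x+y e b))

  ·-monoˡ-≤ : ∀ e {a b} → a ≤ b → a · e ≤ b · e
  ·-monoˡ-≤ e {a} {b} a≤b = trans (sym (·-distribʳ a b e)) (cong (_· e) a≤b)

  ·-monoʳ-≤ : ∀ e {a b} → a ≤ b → e · a ≤ e · b
  ·-monoʳ-≤ e {a} {b} a≤b = ≤-trans (x≤x+y (e · a) (e · b))
    (subst (λ t → e · a + e · b ≤ e · t) a≤b (·-subdistribˡ e a b))

module DpKleeneAlgebraProperties {c : Level} (K : DpKleeneAlgebra c) where
  open DpKleeneAlgebra K
  open ProtoDioidOrder protoDioid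
  open import Relation.Binary.Reasoning.PartialOrder ≤-poset

  ·-⋆-unfold : ∀ p y → p + p · (y · y ⋆) ≤ p · y ⋆
  ·-⋆-unfold p y = begin
    p + p · (y · y ⋆)      ≡⟨ cong (_+ p · (y · y ⋆)) (·-identityʳ p) ⟨
    p · 𝟙 + p · (y · y ⋆)  ≤⟨ ·-subdistribˡ p 𝟙 (y · y ⋆) ⟩
    p · (𝟙 + y · y ⋆)      ≤⟨ ·-monoʳ-≤ p (⋆-unfold y) ⟩
    p · y ⋆                ∎

  d-simulation-· : ∀ x y z w → x · d z ≤ d z · y → x · (d z · w) ≤ d z · (y · w)
  d-simulation-· x y z w xp≤py = begin
    x · (d z · w)  ≡⟨ ·-assoc-d x (d z) w (z , inj₂ (inj₁ refl)) ⟩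
    (x · d z) · w  ≤⟨ ·-monoˡ-≤ w xp≤py ⟩
    (d z · y) · w  ≡⟨ ·-assoc-d (d z) y w (z , inj₁ refl) ⟨
    d z · (y · w)  ∎

lemma10p10 : ∀ {c : Level} (K : DpKleeneAlgebra c) →
    let open DpKleeneAlgebra K in
    ∀ (x y p : Carrier) → (∃[ z ] p ≡ d z) →
    x · p ≤ p · y → (x ⋆) · p ≤ p · (y ⋆)
lemma10p10 K x y p (z , refl) xp≤py =
  ⋆-induct x (p · y ⋆) z
    (≤-trans (+-monoʳ-≤ p (d-simulation-· x y z (y ⋆) xp≤py))
             (·-⋆-unfold p y))
  where
  open DpKleeneAlgebra K
  open ProtoDioidOrder protoDioid
  open DpKleeneAlgebraProperties K
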